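{- Let $g$ be a normalized arithmetic function of moderate growth, and let $\tilde g(n):=g(n)/n$. Let $1\le m<n$. Then $$\frac{1}{n!}\sum_{\mu\vdash n-m}\mathcal{G}(\mu)\prod_{k=0}^{|\mu|+\ell(\mu)-1}(n-k)\sum_{\lambda\in\mathrm{Orb}(\mu)}\prod_{k=1}^{\ell(\lambda)}\Big(k+\sum_{i=1}^k\lambda_i\Big)^{ -1}=\frac{1}{m!}\sum_{\mu\vdash n-m}\widetilde{\mathcal{G}}(\mu)\,\frac{\ell(\mu)!}{\prod_{j\ge1}\mathfrak{m}_j(\mu)!}\binom{n-|\mu|}{\ell(\mu)}.$$
   Context: An arithmetic function is a map $f:\mathbb{N}=\{1,2,\dots\}\to\mathbb{C}$; it is normalized if $f(1)=1$. $g$ has moderate growth if its generating series $\sum_{n\ge1}g(n)q^n$ is regular at $q=0$ (has positive radius of convergence). For a partition $\mu=(\mu_1,\dots,\mu_r)$ (non-increasing positive integers), $\ell(\mu)=r$, $|\mu|=\sum\mu_i$, $\mathfrak{m}_j(\mu)=|\{i:\mu_i=j\}|$, $\mathcal{G}(\mu):=\prod_{k=1}^r g(\mu_k+1)$, $\widetilde{\mathcal{G}}(\mu):=\prod_{k=1}^r\tilde g(\mu_k+1)$; $\mu\vdash N$ means $|\mu|=N$. $\mathrm{Orb}(\mu)$ is the set of distinct compositions obtained by permuting the parts of $\mu$. -}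

module Defs where

open import Level using (Level)
open import Data.Bool using (Bool; true; false; _∧_)
open import Data.Nat as ℕ using (ℕ; zero; suc; _∸_; _≤ᵇ_)
open import Data.Nat.Combinatorics using (_C_)
open import Data.Nat using (_!)
open import Data.Nat.ListAction using (sum; product)
open import Data.Integer using (+_)
open import Data.List using (List; []; _∷_; [_]; map; concatMap; upTo; filter; filterᵇ; length; deduplicate; foldr)
open import Data.List.Properties using (≡-dec)
open import Data.Rational as ℚ using (ℚ; _/_; 0ℚ)
open import Data.Rational.Properties using (+-*-commutativeRing)
open import Algebra.Bundles using (CommutativeRing)
open import Algebra.Morphism.Structures using (module RingMorphisms)
open import Relation.Nullary.Decidable using (does)

-- compositions of n : lists of positive naturals summing to n
-- (the first argument is fuel; compositions n uses fuel n, which suffices)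
compsF : ℕ → ℕ → List (List ℕ)
compsF _ zero = [ [] ]
compsF zero (suc n) = []
compsF (suc f) (suc n) =
  concatMap (λ j → map (suc j ∷_) (compsF f (n ∸ j))) (upTo (suc n))

compositions : ℕ → List (List ℕ)
compositions n = compsF n n

nonIncr : List ℕ → Bool
nonIncr [] = true
nonIncr (x ∷ []) = true
nonIncr (x ∷ y ∷ xs) = (y ≤ᵇ x) ∧ nonIncr (y ∷ xs)

partitions : ℕ → List (List ℕ)
partitions N = filterᵇ nonIncr (compositions N)

insertions : ℕ → List ℕ → List (List ℕ)
insertions x [] = [ x ∷ [] ]
insertions x (y ∷ ys) = (x ∷ y ∷ ys) ∷ map (y ∷_) (insertions x ys)

perms : List ℕ → List (List ℕ)
perms [] = [ [] ]
perms (x ∷ xs) = concatMap (insertions x) (perms xs)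

Orb : List ℕ → List (List ℕ)
Orb μ = deduplicate (≡-dec ℕ._≟_) (perms μ)

mult : ℕ → List ℕ → ℕ
mult j μ = length (filter (λ x → j ℕ.≟ x) μ)

-- 1/k as a rational (only ever applied to k ≥ 1; inv 0 = 0 is a junk value)
inv : ℕ → ℚ
inv zero = 0ℚ
inv (suc k) = + 1 / suc k

toℚ : ℕ → ℚ
toℚ k = + k / 1

-- ∏_{k=0}^{L-1} (n - k)   (falling factorial; truncated subtraction is
-- harmless since a factor 0 occurs before any would-be negative factor)
fallProd : ℕ → ℕ → ℕ
fallProd n L = product (map (λ k → n ∸ k) (upTo L))

-- ∏_{k=1}^{ℓ(λ)} (k + λ_1 + ... + λ_k)^{-1}
invPartialProd : List ℕ → ℚ
invPartialProd λ' = go 1 0 λ'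
  where
  go : ℕ → ℕ → List ℕ → ℚ
  go k s [] = ℚ.1ℚ
  go k s (x ∷ xs) = inv (k ℕ.+ (s ℕ.+ x)) ℚ.* go (suc k) (s ℕ.+ x) xs

sumℚ : List ℚ → ℚ
sumℚ = foldr ℚ._+_ 0ℚ

-- ∏_{j ≥ 1} 𝔪_j(μ)!   (𝔪_j(μ) = 0 for j > |μ|)
multFactProd : List ℕ → ℕ
multFactProd μ = product (map (λ j → (mult (suc j) μ) !) (upTo (sum μ)))

-- ℚ-algebras: a commutative ring R with a unital ring homomorphism ℚ → R

ℚring : CommutativeRing _ _
ℚring = +-*-commutativeRing

module _ {c ℓ : Level} (R : CommutativeRing c ℓ) where
  open CommutativeRing R

  IsℚAlgebraMap : (ℚ → Carrier) → Set ℓ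
  IsℚAlgebraMap ι =
    RingMorphisms.IsRingHomomorphism (CommutativeRing.rawRing ℚring) rawRing ι

  sumR : List Carrier → Carrier
  sumR = foldr _+_ 0#

  prodR : List Carrier → Carrier
  prodR = foldr _*_ 1#

  module _ (ι : ℚ → Carrier) (g : ℕ → Carrier) where

    𝒢 : List ℕ → Carrier
    𝒢 μ = prodR (map (λ x → g (suc x)) μ)

    g̃ : ℕ → Carrier
    g̃ k = ι (inv k) * g k

    𝒢̃ : List ℕ → Carrier
    𝒢̃ μ = prodR (map (λ x → g̃ (suc x)) μ)

    LHS : ℕ → ℕ → Carrier
    LHS m n =
      ι (inv (n !)) *
      sumR (map (λ μ → 𝒢 μ *
                  (ι (toℚ (fallProd n (sum μ ℕ.+ length μ))) *
                   ι (sumℚ (map invPartialProd (Orb μ)))))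
                (partitions (n ∸ m)))

    RHS : ℕ → ℕ → Carrier
    RHS m n =
      ι (inv (m !)) *
      sumR (map (λ μ → 𝒢̃ μ *
                  (ι (toℚ ((length μ) !) ℚ.* inv (multFactProd μ)) *
                   ι (toℚ ((n ∸ sum μ) C (length μ)))))
                (partitions (n ∸ m)))

{-# OPTIONS --safe #-}

-- Put x_i = μ_i + 1, so that k + λ_1 + … + λ_k is the k-th partial sum of the
-- x's in the order λ.  Splitting off the last part, whose factor is always
-- 1/(x_1 + … + x_r), and recursing over the remaining parts shows that
-- summing over all orderings gives ∏ 1/x_i.  Orb μ counts every ordering once
-- instead of ∏ 𝔪_j(μ)! times, so the inner sum of the left-hand side is
-- ∏ 1/(μ_i + 1) / ∏ 𝔪_j(μ)!; this is proved by the same recursion, run over the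
-- distinct last parts and weighted by their multiplicities.  As
-- 𝒢̃(μ) = 𝒢(μ) ∏ 1/(μ_i + 1) and, for |μ| = n − m and ℓ = ℓ(μ),
-- (n)_{|μ|+ℓ} / n! = ℓ! C(m, ℓ) / m! (both are 1/(m − ℓ)!, or both vanish), the
-- two sides agree partition by partition.
module Submission where

open import Defs
open import Level using (Level)
open import Algebra.Bundles using (CommutativeSemiring; CommutativeRing)
import Algebra.Properties.CommutativeSemigroup as CommutativeSemigroupProperties
open import Algebra.Morphism.Structures using (module RingMorphisms)
open import Data.Nat as ℕ using (ℕ; zero; suc; _∸_; _≤_; _<_; _!; s≤s; z≤n; NonZero)
import Data.Nat.Properties as ℕₚ
open import Data.Nat.Combinatorics using (_C_; k![n∸k]!∣n!)
open import Data.Nat.Combinatorics.Specification using (nCk≡n!/k![n-k]!; k>n⇒nCk≡0)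
open import Data.Nat.DivMod using (_/_; m/n*n≡m)
open import Data.Nat.ListAction using (sum; product)
open import Data.Nat.ListAction.Properties using (sum-↭; product≢0)
open import Data.Integer as ℤ using (+_)
import Data.Integer.Properties as ℤₚ
open import Data.Rational as ℚ using (ℚ; mkℚ; 0ℚ; 1ℚ; toℚᵘ)
import Data.Rational.Properties as ℚₚ
open import Data.Rational.Solver using () renaming (module +-*-Solver to ℚSolver)
import Data.Rational.Unnormalised as ℚᵘ
import Data.Rational.Unnormalised.Properties as ℚᵘₚ
open import Data.Nat.Coprimality using (1-coprimeTo) renaming (sym to coprime-sym)
open import Data.List
  using (List; []; _∷_; [_]; foldr; filter; length; map; concatMap; _++_; _∷ʳ_; upTo; deduplicate; initLast; _∷ʳ′_)
open import Data.List.Properties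
  using (map-++; map-∘; length-++; filter-++; filter-accept; filter-reject; map-applyUpTo; ≡-dec; ∷ʳ-injective; ∷ʳ-injectiveʳ)
open import Data.List.Membership.Propositional using (_∈_; find; lose)
open import Data.List.Membership.Propositional.Properties
  using (∈-map⁺; ∈-map⁻; ∈-concatMap⁺; ∈-concatMap⁻; ∈-∃++; ∈-++⁺ʳ; ∈-deduplicate⁺; ∈-deduplicate⁻
        ; ∈-upTo⁺; ∈-upTo⁻; ∈-filter⁻)
open import Data.List.Membership.Propositional.Properties.WithK using (unique∧set⇒bag)
open import Data.List.Relation.Binary.BagAndSetEquality using (∼bag⇒↭)
open import Data.List.Relation.Unary.Any using (here; there)
open import Data.List.Relation.Unary.All as All using (All; []; _∷_)
import Data.List.Relation.Unary.All.Properties as Allₚ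
open import Data.List.Relation.Unary.Unique.Propositional using (Unique; []; _∷_)
import Data.List.Relation.Unary.Unique.Propositional.Properties as Uniqueₚ
open import Data.List.Relation.Unary.Unique.DecPropositional.Properties using (deduplicate-!)
open import Data.List.Relation.Binary.Permutation.Propositional
  using (_↭_; ↭-refl; ↭-sym; ↭-trans; ↭-prep; ↭-swap; ↭⇒↭ₛ′; module PermutationReasoning)
open import Data.List.Relation.Binary.Permutation.Propositional.Properties
  using (↭-empty-inv; ↭-length; map⁺; filter-↭; ∈-resp-↭; drop-∷; shift; ∷↭∷ʳ; ¬x∷xs↭[])
open import Data.Product using (_×_; _,_; proj₁)
open import Relation.Nullary.Decidable using (T?)
open import Data.Empty using (⊥-elim)
open import Relation.Nullary using (¬_; yes; no)
open import Function.Bundles using (mk⇔)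
open import Data.List.Relation.Binary.Permutation.Setoid.Properties using (foldr-commMonoid)
open import Data.Sum using (inj₁; inj₂)
open import Function using (_∘_; _∘′_)
open import Relation.Binary.PropositionalEquality
  using (_≡_; _≢_; refl; sym; trans; cong; cong₂; subst; module ≡-Reasoning)

module Sums {c ℓ : Level} (S : CommutativeSemiring c ℓ) where
  open CommutativeSemiring S renaming (refl to ≈-refl; sym to ≈-sym; trans to ≈-trans)
  open CommutativeSemigroupProperties *-commutativeSemigroup using (interchange)
  open CommutativeSemigroupProperties +-commutativeSemigroup using () renaming (interchange to +-interchange)
  open import Relation.Binary.Reasoning.Setoid setoid

  ∑ : List Carrier → Carrier
  ∑ = foldr _+_ 0#

  ∏ : List Carrier → Carrier
  ∏ = foldr _*_ 1#

  ∑-↭ : ∀ {xs ys} → xs ↭ ys → ∑ xs ≈ ∑ ys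
  ∑-↭ p = foldr-commMonoid setoid +-isCommutativeMonoid (↭⇒↭ₛ′ isEquivalence p)

  ∏-↭ : ∀ {xs ys} → xs ↭ ys → ∏ xs ≈ ∏ ys
  ∏-↭ p = foldr-commMonoid setoid *-isCommutativeMonoid (↭⇒↭ₛ′ isEquivalence p)

  ∑-++ : ∀ xs ys → ∑ (xs ++ ys) ≈ ∑ xs + ∑ ys
  ∑-++ []       ys = ≈-sym (+-identityˡ _)
  ∑-++ (x ∷ xs) ys = ≈-trans (+-congˡ (∑-++ xs ys)) (≈-sym (+-assoc x _ _))

  ∑-cong : ∀ {A : Set} {f h : A → Carrier} (L : List A) →
           (∀ {x} → x ∈ L → f x ≈ h x) → ∑ (map f L) ≈ ∑ (map h L)
  ∑-cong []      _   = ≈-refl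
  ∑-cong (x ∷ L) f≈h = +-cong (f≈h (here refl)) (∑-cong L (f≈h ∘′ there))

  ∑-concatMap : ∀ {A B : Set} (f : B → Carrier) (g : A → List B) (U : List A) →
                ∑ (map f (concatMap g U)) ≈ ∑ (map (λ v → ∑ (map f (g v))) U)
  ∑-concatMap f g []      = ≈-refl
  ∑-concatMap f g (v ∷ U) = begin
    ∑ (map f (g v ++ concatMap g U))            ≡⟨ cong ∑ (map-++ f (g v) _) ⟩
    ∑ (map f (g v) ++ map f (concatMap g U))    ≈⟨ ∑-++ (map f (g v)) _ ⟩
    ∑ (map f (g v)) + ∑ (map f (concatMap g U)) ≈⟨ +-congˡ (∑-concatMap f g U) ⟩
    ∑ (map f (g v)) + ∑ (map (λ w → ∑ (map f (g w))) U) ∎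

  ∑-map-+ : ∀ {A : Set} (f h : A → Carrier) (L : List A) →
            ∑ (map (λ x → f x + h x) L) ≈ ∑ (map f L) + ∑ (map h L)
  ∑-map-+ f h []      = ≈-sym (+-identityˡ 0#)
  ∑-map-+ f h (x ∷ L) = ≈-trans (+-congˡ (∑-map-+ f h L)) (+-interchange (f x) (h x) _ _)

  ∑-map-0# : ∀ {A : Set} (L : List A) → ∑ (map (λ _ → 0#) L) ≈ 0#
  ∑-map-0# []      = ≈-refl
  ∑-map-0# (x ∷ L) = ≈-trans (+-identityˡ _) (∑-map-0# L)

  ∏-map-1# : ∀ {A : Set} (L : List A) → ∏ (map (λ _ → 1#) L) ≈ 1#
  ∏-map-1# []      = ≈-refl
  ∏-map-1# (x ∷ L) = ≈-trans (*-identityˡ _) (∏-map-1# L)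

  *-distribˡ-∑ : ∀ {A : Set} (k : Carrier) (f : A → Carrier) (L : List A) →
                 k * ∑ (map f L) ≈ ∑ (map (λ x → k * f x) L)
  *-distribˡ-∑ k f []      = zeroʳ k
  *-distribˡ-∑ k f (x ∷ L) = ≈-trans (distribˡ k (f x) _) (+-congˡ (*-distribˡ-∑ k f L))

  ∏-map-* : ∀ {A : Set} (f h : A → Carrier) (L : List A) →
            ∏ (map (λ x → f x * h x) L) ≈ ∏ (map f L) * ∏ (map h L)
  ∏-map-* f h []      = ≈-sym (*-identityˡ 1#)
  ∏-map-* f h (x ∷ L) = ≈-trans (*-congˡ (∏-map-* f h L)) (interchange (f x) (h x) _ _)

module ℕ∑ = Sums ℕₚ.+-*-commutativeSemiring
module ℚ∑ = Sums (CommutativeRing.commutativeSemiring ℚring)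

toℚᵘ-toℚ : ∀ k → toℚᵘ (toℚ k) ≡ ℚᵘ.mkℚᵘ (+ k) 0
toℚᵘ-toℚ k = cong toℚᵘ (ℚₚ.normalize-coprime (coprime-sym (1-coprimeTo k)))

toℚ-+ : ∀ a b → toℚ (a ℕ.+ b) ≡ toℚ a ℚ.+ toℚ b
toℚ-+ a b = ℚₚ.toℚᵘ-injective (begin
  toℚᵘ (toℚ (a ℕ.+ b))                   ≡⟨ toℚᵘ-toℚ (a ℕ.+ b) ⟩
  ℚᵘ.mkℚᵘ (+ (a ℕ.+ b)) 0                ≈⟨ ℚᵘ.*≡* (cong (ℤ._* + 1) numerators) ⟩
  ℚᵘ.mkℚᵘ (+ a) 0 ℚᵘ.+ ℚᵘ.mkℚᵘ (+ b) 0   ≡⟨ sym (cong₂ ℚᵘ._+_ (toℚᵘ-toℚ a) (toℚᵘ-toℚ b)) ⟩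
  toℚᵘ (toℚ a) ℚᵘ.+ toℚᵘ (toℚ b)         ≈⟨ ℚᵘₚ.≃-sym (ℚₚ.toℚᵘ-homo-+ (toℚ a) (toℚ b)) ⟩
  toℚᵘ (toℚ a ℚ.+ toℚ b)                 ∎)
  where
  open ℚᵘₚ.≃-Reasoning
  numerators : + (a ℕ.+ b) ≡ + a ℤ.* + 1 ℤ.+ + b ℤ.* + 1
  numerators = trans (ℤₚ.pos-+ a b) (sym (cong₂ ℤ._+_ (ℤₚ.*-identityʳ (+ a)) (ℤₚ.*-identityʳ (+ b))))

toℚ-* : ∀ a b → toℚ (a ℕ.* b) ≡ toℚ a ℚ.* toℚ b
toℚ-* a b = ℚₚ.toℚᵘ-injective (begin
  toℚᵘ (toℚ (a ℕ.* b))                   ≡⟨ toℚᵘ-toℚ (a ℕ.* b) ⟩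
  ℚᵘ.mkℚᵘ (+ (a ℕ.* b)) 0                ≈⟨ ℚᵘ.*≡* (cong (ℤ._* + 1) (ℤₚ.pos-* a b)) ⟩
  ℚᵘ.mkℚᵘ (+ a) 0 ℚᵘ.* ℚᵘ.mkℚᵘ (+ b) 0   ≡⟨ sym (cong₂ ℚᵘ._*_ (toℚᵘ-toℚ a) (toℚᵘ-toℚ b)) ⟩
  toℚᵘ (toℚ a) ℚᵘ.* toℚᵘ (toℚ b)         ≈⟨ ℚᵘₚ.≃-sym (ℚₚ.toℚᵘ-homo-* (toℚ a) (toℚ b)) ⟩
  toℚᵘ (toℚ a ℚ.* toℚ b)                 ∎)
  where open ℚᵘₚ.≃-Reasoning

inv-inverseˡ : ∀ k .{{_ : NonZero k}} → inv k ℚ.* toℚ k ≡ 1ℚ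
inv-inverseˡ (suc k) = begin
  inv (suc k) ℚ.* toℚ (suc k)          ≡⟨ cong₂ ℚ._*_ (ℚₚ.normalize-coprime (1-coprimeTo (suc k))) (ℚₚ.normalize-coprime n/1-coprime) ⟩
  ℚ.1/ n/1 ℚ.* n/1                     ≡⟨ ℚₚ.*-inverseˡ n/1 ⟩
  1ℚ                                   ∎
  where
  open ≡-Reasoning
  n/1-coprime = coprime-sym (1-coprimeTo (suc k))
  n/1 = mkℚ (+ suc k) 0 n/1-coprime

inv-*-cofactor : ∀ a {k c} .{{_ : NonZero k}} .{{_ : NonZero c}} →
                 a ℕ.* k ≡ c → inv c ℚ.* toℚ a ≡ inv k
inv-*-cofactor a {k} {c} a*k≡c = begin
  inv c ℚ.* toℚ a                             ≡⟨ sym (ℚₚ.*-identityʳ _) ⟩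
  (inv c ℚ.* toℚ a) ℚ.* 1ℚ                    ≡⟨ cong ((inv c ℚ.* toℚ a) ℚ.*_) (sym (inv-inverseˡ k)) ⟩
  (inv c ℚ.* toℚ a) ℚ.* (inv k ℚ.* toℚ k)     ≡⟨ solve 4 (λ ic a ik k → (ic :* a) :* (ik :* k) := (ic :* (a :* k)) :* ik) refl (inv c) (toℚ a) (inv k) (toℚ k) ⟩
  (inv c ℚ.* (toℚ a ℚ.* toℚ k)) ℚ.* inv k     ≡⟨ cong (λ z → (inv c ℚ.* z) ℚ.* inv k) (trans (sym (toℚ-* a k)) (cong toℚ a*k≡c)) ⟩
  (inv c ℚ.* toℚ c) ℚ.* inv k                 ≡⟨ cong (ℚ._* inv k) (inv-inverseˡ c) ⟩
  1ℚ ℚ.* inv k                                ≡⟨ ℚₚ.*-identityˡ (inv k) ⟩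
  inv k                                       ∎
  where
  open ≡-Reasoning
  open ℚSolver

toℚ-sum : ∀ {A : Set} (h : A → ℕ) (L : List A) → toℚ (sum (map h L)) ≡ sumℚ (map (toℚ ∘ h) L)
toℚ-sum h []      = refl
toℚ-sum h (x ∷ L) = trans (toℚ-+ (h x) _) (cong (toℚ (h x) ℚ.+_) (toℚ-sum h L))

fallProd-suc : ∀ n L → fallProd (suc n) (suc L) ≡ suc n ℕ.* fallProd n L
fallProd-suc n L = cong (λ xs → suc n ℕ.* product xs)
  (trans (map-applyUpTo suc (suc n ∸_) L) (sym (map-applyUpTo (λ k → k) (n ∸_) L)))

fallProd*[n∸L]!≡n! : ∀ {n L} → L ≤ n → fallProd n L ℕ.* (n ∸ L) ! ≡ n !
fallProd*[n∸L]!≡n! {n}     {zero}  _         = ℕₚ.+-identityʳ (n !)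
fallProd*[n∸L]!≡n! {suc n} {suc L} (s≤s L≤n) = begin
  fallProd (suc n) (suc L) ℕ.* (n ∸ L) !  ≡⟨ cong (ℕ._* (n ∸ L) !) (fallProd-suc n L) ⟩
  suc n ℕ.* fallProd n L ℕ.* (n ∸ L) !    ≡⟨ ℕₚ.*-assoc (suc n) (fallProd n L) ((n ∸ L) !) ⟩
  suc n ℕ.* (fallProd n L ℕ.* (n ∸ L) !)  ≡⟨ cong (suc n ℕ.*_) (fallProd*[n∸L]!≡n! L≤n) ⟩
  suc n !                                 ∎
  where open ≡-Reasoning

fallProd-> : ∀ {n L} → n < L → fallProd n L ≡ 0
fallProd-> {zero}  {suc L} _         = refl
fallProd-> {suc n} {suc L} (s≤s n<L) =
  trans (fallProd-suc n L) (trans (cong (suc n ℕ.*_) (fallProd-> n<L)) (ℕₚ.*-zeroʳ (suc n)))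

k!*nCk*[n∸k]!≡n! : ∀ {n k} → k ≤ n → k ! ℕ.* (n C k) ℕ.* (n ∸ k) ! ≡ n !
k!*nCk*[n∸k]!≡n! {n} {k} k≤n = begin
  k ! ℕ.* (n C k) ℕ.* (n ∸ k) !                       ≡⟨ cong (ℕ._* (n ∸ k) !) (ℕₚ.*-comm (k !) (n C k)) ⟩
  (n C k) ℕ.* k ! ℕ.* (n ∸ k) !                       ≡⟨ ℕₚ.*-assoc (n C k) (k !) _ ⟩
  (n C k) ℕ.* (k ! ℕ.* (n ∸ k) !)                     ≡⟨ cong (ℕ._* (k ! ℕ.* (n ∸ k) !)) (nCk≡n!/k![n-k]! k≤n) ⟩
  (n ! / (k ! ℕ.* (n ∸ k) !)) ℕ.* (k ! ℕ.* (n ∸ k) !) ≡⟨ m/n*n≡m (k![n∸k]!∣n! k≤n) ⟩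
  n !                                                 ∎
  where
  open ≡-Reasoning
  instance _ = k ℕₚ.!* (n ∸ k) !≢0

-- Both sides are 1/(m ∸ r)! when r ≤ m, and both vanish when m < r.
fallProd/n!≡r!*mCr/m! : ∀ {m n N} r → m ℕ.+ N ≡ n →
  inv (n !) ℚ.* toℚ (fallProd n (N ℕ.+ r)) ≡ inv (m !) ℚ.* toℚ (r ! ℕ.* (m C r))
fallProd/n!≡r!*mCr/m! {m} {n} {N} r m+N≡n with ℕₚ.≤-<-connex r m
... | inj₁ r≤m = trans (inv-*-cofactor (fallProd n (N ℕ.+ r)) {{(m ∸ r) ℕₚ.!≢0}} {{n ℕₚ.!≢0}} fallProd*[m∸r]!≡n!)
                       (sym (inv-*-cofactor (r ! ℕ.* (m C r)) {{(m ∸ r) ℕₚ.!≢0}} {{m ℕₚ.!≢0}} (k!*nCk*[n∸k]!≡n! r≤m)))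
  where
  n∸[N+r]≡m∸r : n ∸ (N ℕ.+ r) ≡ m ∸ r
  n∸[N+r]≡m∸r = trans (cong (_∸ (N ℕ.+ r)) (trans (sym m+N≡n) (ℕₚ.+-comm m N))) (ℕₚ.[m+n]∸[m+o]≡n∸o N m r)
  fallProd*[m∸r]!≡n! : fallProd n (N ℕ.+ r) ℕ.* (m ∸ r) ! ≡ n !
  fallProd*[m∸r]!≡n! = subst (λ k → fallProd n (N ℕ.+ r) ℕ.* k ! ≡ n !) n∸[N+r]≡m∸r
    (fallProd*[n∸L]!≡n! (subst (N ℕ.+ r ≤_) (trans (ℕₚ.+-comm N m) m+N≡n) (ℕₚ.+-monoʳ-≤ N r≤m)))
... | inj₂ m<r = begin
  inv (n !) ℚ.* toℚ (fallProd n (N ℕ.+ r))  ≡⟨ cong (λ k → inv (n !) ℚ.* toℚ k) (fallProd-> n<N+r) ⟩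
  inv (n !) ℚ.* 0ℚ                          ≡⟨ ℚₚ.*-zeroʳ (inv (n !)) ⟩
  0ℚ                                        ≡⟨ sym (ℚₚ.*-zeroʳ (inv (m !))) ⟩
  inv (m !) ℚ.* toℚ 0                       ≡⟨ cong (λ k → inv (m !) ℚ.* toℚ k) r!*mCr≡0 ⟨
  inv (m !) ℚ.* toℚ (r ! ℕ.* (m C r))       ∎
  where
  open ≡-Reasoning
  n<N+r : n < N ℕ.+ r
  n<N+r = subst (_< N ℕ.+ r) (trans (ℕₚ.+-comm N m) m+N≡n) (ℕₚ.+-monoʳ-< N m<r)
  r!*mCr≡0 : r ! ℕ.* (m C r) ≡ 0
  r!*mCr≡0 = trans (cong (r ! ℕ.*_) (k>n⇒nCk≡0 m<r)) (ℕₚ.*-zeroʳ (r !))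

∈-insertions⁻ : ∀ {x ys l} → l ∈ insertions x ys → l ↭ x ∷ ys
∈-insertions⁻ {ys = []}     (here refl) = ↭-refl
∈-insertions⁻ {ys = y ∷ ys} (here refl) = ↭-refl
∈-insertions⁻ {x} {y ∷ ys} (there p) with ∈-map⁻ (y ∷_) p
... | l , l∈ , refl = ↭-trans (↭-prep y (∈-insertions⁻ l∈)) (↭-swap y x ↭-refl)

∈-insertions⁺ : ∀ x as bs → as ++ x ∷ bs ∈ insertions x (as ++ bs)
∈-insertions⁺ x []       []       = here refl
∈-insertions⁺ x []       (b ∷ bs) = here refl
∈-insertions⁺ x (a ∷ as) bs       = there (∈-map⁺ (a ∷_) (∈-insertions⁺ x as bs))

∈-perms⁻ : ∀ {M l} → l ∈ perms M → l ↭ M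
∈-perms⁻ {[]}     (here refl) = ↭-refl
∈-perms⁻ {x ∷ xs} p with find (∈-concatMap⁻ (insertions x) {xs = perms xs} p)
... | ys , ys∈ , l∈ = ↭-trans (∈-insertions⁻ l∈) (↭-prep x (∈-perms⁻ ys∈))

∈-perms⁺ : ∀ {M l} → l ↭ M → l ∈ perms M
∈-perms⁺ {[]}     p rewrite ↭-empty-inv p = here refl
∈-perms⁺ {x ∷ xs} p with ∈-∃++ (∈-resp-↭ (↭-sym p) (here refl))
... | as , bs , refl = ∈-concatMap⁺ (insertions x) {xs = perms xs}
  (lose (∈-perms⁺ (drop-∷ (↭-trans (↭-sym (shift x as bs)) p))) (∈-insertions⁺ x as bs))

∈-Orb⁻ : ∀ {M l} → l ∈ Orb M → l ↭ M
∈-Orb⁻ {M} p = ∈-perms⁻ (∈-deduplicate⁻ (≡-dec ℕ._≟_) (perms M) p)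

∈-Orb⁺ : ∀ {M l} → l ↭ M → l ∈ Orb M
∈-Orb⁺ p = ∈-deduplicate⁺ (≡-dec ℕ._≟_) (∈-perms⁺ p)

Orb-unique : ∀ M → Unique (Orb M)
Orb-unique M = deduplicate-! (≡-dec ℕ._≟_) (perms M)

remove : ℕ → List ℕ → List ℕ
remove v []       = []
remove v (x ∷ xs) with x ℕ.≟ v
... | yes _ = xs
... | no  _ = x ∷ remove v xs

remove-↭ : ∀ {v M} → v ∈ M → M ↭ v ∷ remove v M
remove-↭ {v} {x ∷ xs} v∈ with x ℕ.≟ v
remove-↭ {v} {x ∷ xs} _          | yes refl = ↭-refl
remove-↭ {v} {x ∷ xs} (here v≡x) | no  x≢v  = ⊥-elim (x≢v (sym v≡x))
remove-↭ {v} {x ∷ xs} (there v∈) | no  _    = ↭-trans (↭-prep x (remove-↭ v∈)) (↭-swap x v ↭-refl)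

distinct : List ℕ → List ℕ
distinct = deduplicate ℕ._≟_

Orb-endingIn : List ℕ → ℕ → List (List ℕ)
Orb-endingIn M v = map (_∷ʳ v) (Orb (remove v M))

Orb-byLast : List ℕ → List (List ℕ)
Orb-byLast M = concatMap (Orb-endingIn M) (distinct M)

∈-Orb-byLast⁻ : ∀ {M l} → l ∈ Orb-byLast M → l ↭ M
∈-Orb-byLast⁻ {M} p with find (∈-concatMap⁻ (Orb-endingIn M) {xs = distinct M} p)
... | v , v∈ , l∈ with ∈-map⁻ (_∷ʳ v) l∈
... | l′ , l′∈ , refl = begin
  l′ ∷ʳ v          ↭⟨ ↭-sym (∷↭∷ʳ v l′) ⟩
  v ∷ l′           ↭⟨ ↭-prep v (∈-Orb⁻ l′∈) ⟩
  v ∷ remove v M   ↭⟨ ↭-sym (remove-↭ (∈-deduplicate⁻ ℕ._≟_ M v∈)) ⟩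
  M                ∎
  where open PermutationReasoning

∈-Orb-byLast⁺ : ∀ {y ys l} → l ↭ y ∷ ys → l ∈ Orb-byLast (y ∷ ys)
∈-Orb-byLast⁺ {y} {ys} {l} p with initLast l
... | []        = ⊥-elim (¬x∷xs↭[] (↭-sym p))
... | l′ ∷ʳ′ v  = ∈-concatMap⁺ (Orb-endingIn M) {xs = distinct M}
  (lose (∈-deduplicate⁺ ℕ._≟_ v∈M) (∈-map⁺ (_∷ʳ v) (∈-Orb⁺ l′↭)))
  where
  M = y ∷ ys
  v∈M : v ∈ M
  v∈M = ∈-resp-↭ p (∈-++⁺ʳ l′ (here refl))
  l′↭ : l′ ↭ remove v M
  l′↭ = drop-∷ (↭-trans (∷↭∷ʳ v l′) (↭-trans p (remove-↭ v∈M)))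

Orb-byLast-unique : ∀ M → Unique (Orb-byLast M)
Orb-byLast-unique M = unique (distinct M) (deduplicate-! ℕ._≟_ M)
  where
  endingIn-unique : ∀ v → Unique (Orb-endingIn M v)
  endingIn-unique v = Uniqueₚ.map⁺ (λ {a} {b} eq → proj₁ (∷ʳ-injective a b eq)) (Orb-unique (remove v M))
  unique : ∀ U → Unique U → Unique (concatMap (Orb-endingIn M) U)
  unique []      []         = []
  unique (v ∷ U) (v∉U ∷ uU) = Uniqueₚ.++⁺ (endingIn-unique v) (unique U uU) disjoint
    where
    disjoint : ∀ {l} → ¬ (l ∈ Orb-endingIn M v × l ∈ concatMap (Orb-endingIn M) U)
    disjoint (l∈v , l∈U) with find (∈-concatMap⁻ (Orb-endingIn M) {xs = U} l∈U)
    ... | w , w∈U , l∈w with ∈-map⁻ (_∷ʳ v) l∈v | ∈-map⁻ (_∷ʳ w) l∈w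
    ... | a , _ , refl | b , _ , eq = All.lookup v∉U w∈U (∷ʳ-injectiveʳ a b eq)

Orb↭Orb-byLast : ∀ y ys → Orb (y ∷ ys) ↭ Orb-byLast (y ∷ ys)
Orb↭Orb-byLast y ys = ∼bag⇒↭ (unique∧set⇒bag (Orb-unique (y ∷ ys)) (Orb-byLast-unique (y ∷ ys))
  (mk⇔ (λ p → ∈-Orb-byLast⁺ {y} {ys} (∈-Orb⁻ {y ∷ ys} p)) (λ p → ∈-Orb⁺ {y ∷ ys} (∈-Orb-byLast⁻ {y ∷ ys} p))))

-- The local helper of invPartialProd is not exported by Defs.  partialProdFrom
-- is a metavariable that unification in partialProdFrom-unfold solves to that
-- helper; its first argument is the (unused) list parameter of the where-block.
mutual
  partialProdFrom : List ℕ → ℕ → ℕ → List ℕ → ℚ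
  partialProdFrom = _

  partialProdFrom-unfold : ∀ x xs →
    invPartialProd (x ∷ xs) ≡ inv (suc x) ℚ.* partialProdFrom (x ∷ xs) 2 x xs
  partialProdFrom-unfold x xs with x ∷ xs | 2
  ... | _ | _ = refl

partialProdFrom-irrelevant : ∀ q q′ k s l → partialProdFrom q k s l ≡ partialProdFrom q′ k s l
partialProdFrom-irrelevant q q′ k s []      = refl
partialProdFrom-irrelevant q q′ k s (x ∷ l) =
  cong (inv (k ℕ.+ (s ℕ.+ x)) ℚ.*_) (partialProdFrom-irrelevant q q′ (suc k) (s ℕ.+ x) l)

partialProdFrom-∷ʳ : ∀ q k s xs x → partialProdFrom q k s (xs ∷ʳ x) ≡
  partialProdFrom q k s xs ℚ.* inv (k ℕ.+ length xs ℕ.+ (s ℕ.+ sum xs ℕ.+ x))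
partialProdFrom-∷ʳ q k s [] x = begin
  inv (k ℕ.+ (s ℕ.+ x)) ℚ.* 1ℚ                    ≡⟨ ℚₚ.*-identityʳ _ ⟩
  inv (k ℕ.+ (s ℕ.+ x))                           ≡⟨ cong₂ (λ a b → inv (a ℕ.+ (b ℕ.+ x))) (ℕₚ.+-identityʳ k) (ℕₚ.+-identityʳ s) ⟨
  inv (k ℕ.+ 0 ℕ.+ (s ℕ.+ 0 ℕ.+ x))               ≡⟨ ℚₚ.*-identityˡ _ ⟨
  1ℚ ℚ.* inv (k ℕ.+ 0 ℕ.+ (s ℕ.+ 0 ℕ.+ x))        ∎
  where open ≡-Reasoning
partialProdFrom-∷ʳ q k s (y ∷ ys) x = begin
  a ℚ.* P (ys ∷ʳ x)                                                   ≡⟨ cong (a ℚ.*_) (partialProdFrom-∷ʳ q (suc k) (s ℕ.+ y) ys x) ⟩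
  a ℚ.* (P ys ℚ.* inv (suc k ℕ.+ length ys ℕ.+ (s ℕ.+ y ℕ.+ sum ys ℕ.+ x))) ≡⟨ ℚₚ.*-assoc a (P ys) _ ⟨
  a ℚ.* P ys ℚ.* inv (suc k ℕ.+ length ys ℕ.+ (s ℕ.+ y ℕ.+ sum ys ℕ.+ x))   ≡⟨ cong (λ z → a ℚ.* P ys ℚ.* inv z) length+sum ⟩
  a ℚ.* P ys ℚ.* inv (k ℕ.+ suc (length ys) ℕ.+ (s ℕ.+ (y ℕ.+ sum ys) ℕ.+ x)) ∎
  where
  open ≡-Reasoning
  a = inv (k ℕ.+ (s ℕ.+ y))
  P = partialProdFrom q (suc k) (s ℕ.+ y)
  length+sum : suc k ℕ.+ length ys ℕ.+ (s ℕ.+ y ℕ.+ sum ys ℕ.+ x) ≡ k ℕ.+ suc (length ys) ℕ.+ (s ℕ.+ (y ℕ.+ sum ys) ℕ.+ x)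
  length+sum = cong₂ (λ a b → a ℕ.+ (b ℕ.+ x)) (sym (ℕₚ.+-suc k (length ys))) (ℕₚ.+-assoc s y (sum ys))

invPartialProd-∷ʳ : ∀ l v → invPartialProd (l ∷ʳ v) ≡ invPartialProd l ℚ.* inv (suc (length l) ℕ.+ (sum l ℕ.+ v))
invPartialProd-∷ʳ []       v = trans (ℚₚ.*-identityʳ (inv (suc v))) (sym (ℚₚ.*-identityˡ (inv (suc v))))
invPartialProd-∷ʳ (x ∷ xs) v = begin
  invPartialProd (x ∷ xs ∷ʳ v)                                ≡⟨ partialProdFrom-unfold x (xs ∷ʳ v) ⟩
  inv (suc x) ℚ.* partialProdFrom (x ∷ xs ∷ʳ v) 2 x (xs ∷ʳ v) ≡⟨ cong (inv (suc x) ℚ.*_) (partialProdFrom-irrelevant (x ∷ xs ∷ʳ v) (x ∷ xs) 2 x (xs ∷ʳ v)) ⟩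
  inv (suc x) ℚ.* partialProdFrom (x ∷ xs) 2 x (xs ∷ʳ v)      ≡⟨ cong (inv (suc x) ℚ.*_) (partialProdFrom-∷ʳ (x ∷ xs) 2 x xs v) ⟩
  inv (suc x) ℚ.* (P ℚ.* inv c)                               ≡⟨ ℚₚ.*-assoc (inv (suc x)) P (inv c) ⟨
  inv (suc x) ℚ.* P ℚ.* inv c                                 ≡⟨ cong (ℚ._* inv c) (partialProdFrom-unfold x xs) ⟨
  invPartialProd (x ∷ xs) ℚ.* inv c                           ∎
  where
  open ≡-Reasoning
  P = partialProdFrom (x ∷ xs) 2 x xs
  c = 2 ℕ.+ length xs ℕ.+ (x ℕ.+ sum xs ℕ.+ v)

orbitSum : List ℕ → ℚ
orbitSum M = sumℚ (map invPartialProd (Orb M))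

orbitSum-∷ : ∀ y ys → let M = y ∷ ys in
  orbitSum M ≡ inv (length M ℕ.+ sum M) ℚ.* sumℚ (map (λ v → orbitSum (remove v M)) (distinct M))
orbitSum-∷ y ys = begin
  sumℚ (map invPartialProd (Orb M))                                  ≡⟨ ℚ∑.∑-↭ (map⁺ invPartialProd (Orb↭Orb-byLast y ys)) ⟩
  sumℚ (map invPartialProd (Orb-byLast M))                           ≡⟨ ℚ∑.∑-concatMap invPartialProd (Orb-endingIn M) (distinct M) ⟩
  sumℚ (map (λ v → sumℚ (map invPartialProd (Orb-endingIn M v))) (distinct M))
                                                                     ≡⟨ ℚ∑.∑-cong (distinct M) (λ v∈ → endingIn (∈-deduplicate⁻ ℕ._≟_ M v∈)) ⟩
  sumℚ (map (λ v → c ℚ.* orbitSum (remove v M)) (distinct M))        ≡⟨ ℚ∑.*-distribˡ-∑ c (λ v → orbitSum (remove v M)) (distinct M) ⟨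
  c ℚ.* sumℚ (map (λ v → orbitSum (remove v M)) (distinct M))        ∎
  where
  open ≡-Reasoning
  M = y ∷ ys
  c = inv (length M ℕ.+ sum M)
  last-factor : ∀ {v l} → v ∈ M → l ↭ remove v M → invPartialProd (l ∷ʳ v) ≡ c ℚ.* invPartialProd l
  last-factor {v} {l} v∈M l↭ = begin
    invPartialProd (l ∷ʳ v)                                        ≡⟨ invPartialProd-∷ʳ l v ⟩
    invPartialProd l ℚ.* inv (suc (length l) ℕ.+ (sum l ℕ.+ v))    ≡⟨ ℚₚ.*-comm (invPartialProd l) _ ⟩
    inv (suc (length l) ℕ.+ (sum l ℕ.+ v)) ℚ.* invPartialProd l    ≡⟨ cong (λ k → inv k ℚ.* invPartialProd l) length+sum ⟩
    c ℚ.* invPartialProd l                                         ∎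
    where
    v∷l↭M : v ∷ l ↭ M
    v∷l↭M = ↭-trans (↭-prep v l↭) (↭-sym (remove-↭ v∈M))
    length+sum : suc (length l) ℕ.+ (sum l ℕ.+ v) ≡ length M ℕ.+ sum M
    length+sum = cong₂ ℕ._+_ (↭-length v∷l↭M) (trans (ℕₚ.+-comm (sum l) v) (sum-↭ v∷l↭M))
  endingIn : ∀ {v} → v ∈ M → sumℚ (map invPartialProd (Orb-endingIn M v)) ≡ c ℚ.* orbitSum (remove v M)
  endingIn {v} v∈M = begin
    sumℚ (map invPartialProd (map (_∷ʳ v) (Orb (remove v M)))) ≡⟨ cong sumℚ (map-∘ (Orb (remove v M))) ⟨
    sumℚ (map (λ l → invPartialProd (l ∷ʳ v)) (Orb (remove v M))) ≡⟨ ℚ∑.∑-cong (Orb (remove v M)) (λ l∈ → last-factor v∈M (∈-Orb⁻ l∈)) ⟩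
    sumℚ (map (λ l → c ℚ.* invPartialProd l) (Orb (remove v M)))  ≡⟨ ℚ∑.*-distribˡ-∑ c invPartialProd (Orb (remove v M)) ⟨
    c ℚ.* orbitSum (remove v M)                                   ∎

mult-∷-≡ : ∀ v xs → mult v (v ∷ xs) ≡ suc (mult v xs)
mult-∷-≡ v xs = cong length (filter-accept (v ℕ.≟_) refl)

mult-∷-≢ : ∀ {v x} xs → v ≢ x → mult v (x ∷ xs) ≡ mult v xs
mult-∷-≢ {v} xs v≢x = cong length (filter-reject (v ℕ.≟_) v≢x)

mult-++ : ∀ v xs ys → mult v (xs ++ ys) ≡ mult v xs ℕ.+ mult v ys
mult-++ v xs ys = trans (cong length (filter-++ (v ℕ.≟_) xs ys)) (length-++ (filter (v ℕ.≟_) xs))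

mult-↭ : ∀ v {xs ys} → xs ↭ ys → mult v xs ≡ mult v ys
mult-↭ v p = ↭-length (filter-↭ (v ℕ.≟_) p)

mult-remove-≡ : ∀ {v M} → v ∈ M → mult v M ≡ suc (mult v (remove v M))
mult-remove-≡ {v} {M} v∈M = trans (mult-↭ v (remove-↭ v∈M)) (mult-∷-≡ v (remove v M))

mult-remove-≢ : ∀ {v j M} → v ∈ M → j ≢ v → mult j M ≡ mult j (remove v M)
mult-remove-≢ {v} {j} {M} v∈M j≢v = trans (mult-↭ j (remove-↭ v∈M)) (mult-∷-≢ (remove v M) j≢v)

∑-mult-[x] : ∀ (h : ℕ → ℕ) {U x} → Unique U → x ∈ U → sum (map (λ v → mult v [ x ] ℕ.* h v) U) ≡ h x
∑-mult-[x] h {u ∷ U} (u∉U ∷ _) (here refl) = begin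
  mult u [ u ] ℕ.* h u ℕ.+ sum (map (λ v → mult v [ u ] ℕ.* h v) U) ≡⟨ cong₂ ℕ._+_ (trans (cong (ℕ._* h u) (mult-∷-≡ u [])) (ℕₚ.*-identityˡ (h u))) rest≡0 ⟩
  h u ℕ.+ 0                                                         ≡⟨ ℕₚ.+-identityʳ (h u) ⟩
  h u                                                               ∎
  where
  open ≡-Reasoning
  rest≡0 : sum (map (λ v → mult v [ u ] ℕ.* h v) U) ≡ 0
  rest≡0 = trans (ℕ∑.∑-cong U (λ {v} v∈U → cong (ℕ._* h v) (mult-∷-≢ [] (λ v≡u → All.lookup u∉U v∈U (sym v≡u)))))
                 (ℕ∑.∑-map-0# U)
∑-mult-[x] h {u ∷ U} {x} (u∉U ∷ uU) (there x∈U) =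
  cong₂ ℕ._+_ (cong (ℕ._* h u) (mult-∷-≢ {u} {x} [] (All.lookup u∉U x∈U))) (∑-mult-[x] h uU x∈U)

∑-mult* : ∀ (h : ℕ → ℕ) {U} → Unique U → ∀ M → (∀ {x} → x ∈ M → x ∈ U) →
          sum (map (λ v → mult v M ℕ.* h v) U) ≡ sum (map h M)
∑-mult* h {U} uU []      _   = ℕ∑.∑-map-0# U
∑-mult* h {U} uU (x ∷ M) M⊆U = begin
  sum (map (λ v → mult v (x ∷ M) ℕ.* h v) U)
    ≡⟨ ℕ∑.∑-cong U (λ {v} _ → trans (cong (ℕ._* h v) (mult-++ v [ x ] M)) (ℕₚ.*-distribʳ-+ (h v) (mult v [ x ]) (mult v M))) ⟩
  sum (map (λ v → mult v [ x ] ℕ.* h v ℕ.+ mult v M ℕ.* h v) U)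
    ≡⟨ ℕ∑.∑-map-+ (λ v → mult v [ x ] ℕ.* h v) (λ v → mult v M ℕ.* h v) U ⟩
  sum (map (λ v → mult v [ x ] ℕ.* h v) U) ℕ.+ sum (map (λ v → mult v M ℕ.* h v) U)
    ≡⟨ cong₂ ℕ._+_ (∑-mult-[x] h uU (M⊆U (here refl))) (∑-mult* h uU M (M⊆U ∘ there)) ⟩
  h x ℕ.+ sum (map h M) ∎
  where open ≡-Reasoning

product-map-update : ∀ (f g : ℕ → ℕ) c {w L} → Unique L → w ∈ L →
  (∀ {j} → j ≢ w → f j ≡ g j) → f w ≡ c ℕ.* g w → product (map f L) ≡ c ℕ.* product (map g L)
product-map-update f g c {L = j ∷ L} (j∉L ∷ _) (here refl) f≡g fw≡c*gw = begin
  f j ℕ.* product (map f L)         ≡⟨ cong₂ ℕ._*_ fw≡c*gw (cong product (map-cong-∈ L (λ i∈L → f≡g (λ i≡j → All.lookup j∉L i∈L (sym i≡j))))) ⟩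
  c ℕ.* g j ℕ.* product (map g L)   ≡⟨ ℕₚ.*-assoc c (g j) _ ⟩
  c ℕ.* (g j ℕ.* product (map g L)) ∎
  where
  open ≡-Reasoning
  map-cong-∈ : ∀ L → (∀ {i} → i ∈ L → f i ≡ g i) → map f L ≡ map g L
  map-cong-∈ []      _ = refl
  map-cong-∈ (i ∷ L) eq = cong₂ _∷_ (eq (here refl)) (map-cong-∈ L (eq ∘ there))
product-map-update f g c {L = j ∷ L} (j∉L ∷ uL) (there w∈L) f≡g fw≡c*gw = begin
  f j ℕ.* product (map f L)           ≡⟨ cong₂ ℕ._*_ (f≡g (λ j≡w → All.lookup j∉L w∈L j≡w)) (product-map-update f g c uL w∈L f≡g fw≡c*gw) ⟩
  g j ℕ.* (c ℕ.* product (map g L))   ≡⟨ CommutativeSemigroupProperties.x∙yz≈y∙xz ℕₚ.*-commutativeSemigroup (g j) c _ ⟩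
  c ℕ.* (g j ℕ.* product (map g L))   ∎
  where open ≡-Reasoning

multFactProdUpTo : ℕ → List ℕ → ℕ
multFactProdUpTo B M = product (map (λ j → mult (suc j) M !) (upTo B))

multFactProdUpTo-remove : ∀ {B w M} → suc w ∈ M → w < B →
  multFactProdUpTo B M ≡ mult (suc w) M ℕ.* multFactProdUpTo B (remove (suc w) M)
multFactProdUpTo-remove {B} {w} {M} v∈M w<B =
  product-map-update (λ j → mult (suc j) M !) (λ j → mult (suc j) (remove (suc w) M) !) (mult (suc w) M)
    (Uniqueₚ.upTo⁺ B) (∈-upTo⁺ w<B)
    (λ j≢w → cong _! (mult-remove-≢ v∈M (j≢w ∘ ℕₚ.suc-injective)))
    (trans (cong _! (mult-remove-≡ v∈M)) (cong (ℕ._* (mult (suc w) (remove (suc w) M) !)) (sym (mult-remove-≡ v∈M))))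

invSucProd : List ℕ → ℚ
invSucProd M = ℚ∑.∏ (map (λ x → inv (suc x)) M)

invSucProd-remove : ∀ {v M} → v ∈ M → invSucProd (remove v M) ≡ toℚ (suc v) ℚ.* invSucProd M
invSucProd-remove {v} {M} v∈M = sym (begin
  toℚ (suc v) ℚ.* invSucProd M                        ≡⟨ cong (toℚ (suc v) ℚ.*_) (ℚ∑.∏-↭ (map⁺ (λ x → inv (suc x)) (remove-↭ v∈M))) ⟩
  toℚ (suc v) ℚ.* (inv (suc v) ℚ.* invSucProd R)      ≡⟨ ℚₚ.*-assoc (toℚ (suc v)) (inv (suc v)) (invSucProd R) ⟨
  toℚ (suc v) ℚ.* inv (suc v) ℚ.* invSucProd R        ≡⟨ cong (ℚ._* invSucProd R) (trans (ℚₚ.*-comm (toℚ (suc v)) (inv (suc v))) (inv-inverseˡ (suc v))) ⟩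
  1ℚ ℚ.* invSucProd R                                 ≡⟨ ℚₚ.*-identityˡ (invSucProd R) ⟩
  invSucProd R                                        ∎)
  where
  open ≡-Reasoning
  R = remove v M

sum-map-suc : ∀ M → sum (map suc M) ≡ length M ℕ.+ sum M
sum-map-suc []      = refl
sum-map-suc (x ∷ M) = cong suc (trans (cong (x ℕ.+_) (sum-map-suc M))
  (CommutativeSemigroupProperties.x∙yz≈y∙xz ℕₚ.+-commutativeSemigroup x (length M) (sum M)))

∑-mult*suc : ∀ M → sum (map (λ v → mult v M ℕ.* suc v) (distinct M)) ≡ length M ℕ.+ sum M
∑-mult*suc M = trans (∑-mult* suc (deduplicate-! ℕ._≟_ M) M (∈-deduplicate⁺ ℕ._≟_)) (sum-map-suc M)

PartsIn : ℕ → List ℕ → Set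
PartsIn B M = All (λ x → 1 ≤ x × x ≤ B) M

multFactProdUpTo*orbitSum-remove : ∀ {B w M} → let v = suc w; R = remove v M in v ∈ M → w < B →
  orbitSum R ℚ.* toℚ (multFactProdUpTo B R) ≡ invSucProd R →
  toℚ (multFactProdUpTo B M) ℚ.* orbitSum R ≡ invSucProd M ℚ.* toℚ (mult v M ℕ.* suc v)
multFactProdUpTo*orbitSum-remove {B} {w} {M} v∈M w<B hyp = begin
  toℚ (multFactProdUpTo B M) ℚ.* orbitSum R ≡⟨ cong (λ k → toℚ k ℚ.* orbitSum R) (multFactProdUpTo-remove v∈M w<B) ⟩
  toℚ (m ℕ.* P) ℚ.* orbitSum R              ≡⟨ cong (ℚ._* orbitSum R) (toℚ-* m P) ⟩
  toℚ m ℚ.* toℚ P ℚ.* orbitSum R            ≡⟨ solve 3 (λ m p o → m :* p :* o := m :* (o :* p)) refl (toℚ m) (toℚ P) (orbitSum R) ⟩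
  toℚ m ℚ.* (orbitSum R ℚ.* toℚ P)          ≡⟨ cong (toℚ m ℚ.*_) (trans hyp (invSucProd-remove v∈M)) ⟩
  toℚ m ℚ.* (toℚ (suc v) ℚ.* invSucProd M)  ≡⟨ solve 3 (λ m s q → m :* (s :* q) := q :* (m :* s)) refl (toℚ m) (toℚ (suc v)) (invSucProd M) ⟩
  invSucProd M ℚ.* (toℚ m ℚ.* toℚ (suc v))  ≡⟨ cong (invSucProd M ℚ.*_) (toℚ-* m (suc v)) ⟨
  invSucProd M ℚ.* toℚ (m ℕ.* suc v)        ∎
  where
  open ≡-Reasoning
  open ℚSolver
  v = suc w
  R = remove v M
  m = mult v M
  P = multFactProdUpTo B R

orbitSum*multFactProdUpTo-∷ : ∀ {B} y ys → let M = y ∷ ys in PartsIn B M →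
  (∀ {v} → v ∈ M → orbitSum (remove v M) ℚ.* toℚ (multFactProdUpTo B (remove v M)) ≡ invSucProd (remove v M)) →
  orbitSum M ℚ.* toℚ (multFactProdUpTo B M) ≡ invSucProd M
orbitSum*multFactProdUpTo-∷ {B} y ys parts hyp = begin
  orbitSum M ℚ.* t                  ≡⟨ cong (ℚ._* t) (orbitSum-∷ y ys) ⟩
  c ℚ.* S F ℚ.* t                   ≡⟨ solve 3 (λ c s t → c :* s :* t := c :* (t :* s)) refl c (S F) t ⟩
  c ℚ.* (t ℚ.* S F)                 ≡⟨ cong (c ℚ.*_) (ℚ∑.*-distribˡ-∑ t F (distinct M)) ⟩
  c ℚ.* S (λ v → t ℚ.* F v)         ≡⟨ cong (c ℚ.*_) (ℚ∑.∑-cong (distinct M) (removing ∘ ∈-deduplicate⁻ ℕ._≟_ M)) ⟩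
  c ℚ.* S (λ v → q ℚ.* W v)         ≡⟨ cong (c ℚ.*_) (ℚ∑.*-distribˡ-∑ q W (distinct M)) ⟨
  c ℚ.* (q ℚ.* S W)                 ≡⟨ cong (λ z → c ℚ.* (q ℚ.* z)) S[W]≡N ⟩
  c ℚ.* (q ℚ.* toℚ N)               ≡⟨ solve 3 (λ c q n → c :* (q :* n) := (c :* n) :* q) refl c q (toℚ N) ⟩
  c ℚ.* toℚ N ℚ.* q                 ≡⟨ cong (ℚ._* q) (inv-inverseˡ N) ⟩
  1ℚ ℚ.* q                          ≡⟨ ℚₚ.*-identityˡ q ⟩
  q                                 ∎
  where
  open ≡-Reasoning
  open ℚSolver
  M = y ∷ ys
  N = length M ℕ.+ sum M
  c = inv N
  t = toℚ (multFactProdUpTo B M)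
  q = invSucProd M
  F W : ℕ → ℚ
  F v = orbitSum (remove v M)
  W v = toℚ (mult v M ℕ.* suc v)
  S : (ℕ → ℚ) → ℚ
  S f = sumℚ (map f (distinct M))
  S[W]≡N : S W ≡ toℚ N
  S[W]≡N = trans (sym (toℚ-sum (λ v → mult v M ℕ.* suc v) (distinct M))) (cong toℚ (∑-mult*suc M))
  removing : ∀ {v} → v ∈ M → t ℚ.* F v ≡ q ℚ.* W v
  removing v∈M with All.lookup parts v∈M
  removing {suc w} v∈M | _ , v≤B = multFactProdUpTo*orbitSum-remove v∈M v≤B (hyp v∈M)

orbitSum*multFactProdUpTo : ∀ B M → PartsIn B M → orbitSum M ℚ.* toℚ (multFactProdUpTo B M) ≡ invSucProd M
orbitSum*multFactProdUpTo B M = byLength M refl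
  where
  byLength : ∀ {n} M → length M ≡ n → PartsIn B M → orbitSum M ℚ.* toℚ (multFactProdUpTo B M) ≡ invSucProd M
  byLength []       _ _ = cong (λ k → orbitSum [] ℚ.* toℚ k) (ℕ∑.∏-map-1# (upTo B))
  byLength {suc n} (y ∷ ys) |M|≡1+n parts = orbitSum*multFactProdUpTo-∷ y ys parts (λ v∈M →
    let M↭ = remove-↭ v∈M in
    byLength (remove _ (y ∷ ys)) (ℕₚ.suc-injective (trans (sym (↭-length M↭)) |M|≡1+n))
      (All.tabulate (λ x∈ → All.lookup parts (∈-resp-↭ (↭-sym M↭) (there x∈)))))

∈-compsF⁻ : ∀ {f n μ} → μ ∈ compsF f n → sum μ ≡ n × All (1 ≤_) μ
∈-compsF⁻ {n = zero}  (here refl) = refl , []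
∈-compsF⁻ {suc f} {suc n} μ∈ with find (∈-concatMap⁻ (λ j → map (suc j ∷_) (compsF f (n ∸ j))) {xs = upTo (suc n)} μ∈)
... | j , j∈ , μ∈j with ∈-map⁻ (suc j ∷_) μ∈j
... | μ′ , μ′∈ , refl with ∈-compsF⁻ {f} {n ∸ j} μ′∈
... | sum≡ , pos = cong suc (trans (cong (j ℕ.+_) sum≡) (ℕₚ.m+[n∸m]≡n (ℕₚ.≤-pred (∈-upTo⁻ j∈)))) , s≤s z≤n ∷ pos

∈-partitions⁻ : ∀ {N μ} → μ ∈ partitions N → sum μ ≡ N × All (1 ≤_) μ
∈-partitions⁻ {N} μ∈ = ∈-compsF⁻ (proj₁ (∈-filter⁻ (T? ∘ nonIncr) {xs = compositions N} μ∈))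

∈⇒≤sum : ∀ {x μ} → x ∈ μ → x ≤ sum μ
∈⇒≤sum {x} {y ∷ μ} (here refl) = ℕₚ.m≤m+n x (sum μ)
∈⇒≤sum {x} {y ∷ μ} (there x∈μ) = ℕₚ.≤-trans (∈⇒≤sum x∈μ) (ℕₚ.m≤n+m (sum μ) y)

orbitSum-partition : ∀ {μ} → All (1 ≤_) μ → orbitSum μ ≡ invSucProd μ ℚ.* inv (multFactProd μ)
orbitSum-partition {μ} pos = begin
  orbitSum μ                                      ≡⟨ ℚₚ.*-identityʳ (orbitSum μ) ⟨
  orbitSum μ ℚ.* 1ℚ                               ≡⟨ cong (orbitSum μ ℚ.*_) (trans (ℚₚ.*-comm (toℚ X) (inv X)) (inv-inverseˡ X)) ⟨
  orbitSum μ ℚ.* (toℚ X ℚ.* inv X)                ≡⟨ ℚₚ.*-assoc (orbitSum μ) (toℚ X) (inv X) ⟨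
  orbitSum μ ℚ.* toℚ X ℚ.* inv X                  ≡⟨ cong (ℚ._* inv X) (orbitSum*multFactProdUpTo (sum μ) μ parts) ⟩
  invSucProd μ ℚ.* inv X                          ∎
  where
  open ≡-Reasoning
  X = multFactProd μ
  instance
    X≢0 : NonZero X
    X≢0 = product≢0 (Allₚ.map⁺ (All.universal (λ j → mult (suc j) μ ℕₚ.!≢0) (upTo (sum μ))))
  parts : PartsIn (sum μ) μ
  parts = All.tabulate (λ x∈μ → All.lookup pos x∈μ , ∈⇒≤sum x∈μ)

partition-term : ∀ {m n μ} → m ℕ.+ sum μ ≡ n → All (1 ≤_) μ →
  inv (n !) ℚ.* (toℚ (fallProd n (sum μ ℕ.+ length μ)) ℚ.* orbitSum μ) ≡
  inv (m !) ℚ.* (invSucProd μ ℚ.* ((toℚ (length μ !) ℚ.* inv (multFactProd μ)) ℚ.* toℚ ((n ∸ sum μ) C length μ)))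
partition-term {m} {n} {μ} m+|μ|≡n pos = begin
  a ℚ.* (toℚ (fallProd n (sum μ ℕ.+ r)) ℚ.* orbitSum μ)  ≡⟨ ℚₚ.*-assoc a (toℚ (fallProd n (sum μ ℕ.+ r))) (orbitSum μ) ⟨
  a ℚ.* toℚ (fallProd n (sum μ ℕ.+ r)) ℚ.* orbitSum μ    ≡⟨ cong₂ ℚ._*_ (fallProd/n!≡r!*mCr/m! {N = sum μ} r m+|μ|≡n) (orbitSum-partition pos) ⟩
  a′ ℚ.* toℚ (r ! ℕ.* (m C r)) ℚ.* (q ℚ.* inv X)         ≡⟨ cong (λ z → a′ ℚ.* z ℚ.* (q ℚ.* inv X)) (toℚ-* (r !) (m C r)) ⟩
  a′ ℚ.* (toℚ (r !) ℚ.* C′) ℚ.* (q ℚ.* inv X)            ≡⟨ solve 5 (λ a f c q x → a :* (f :* c) :* (q :* x) := a :* (q :* ((f :* x) :* c))) refl a′ (toℚ (r !)) C′ q (inv X) ⟩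
  a′ ℚ.* (q ℚ.* ((toℚ (r !) ℚ.* inv X) ℚ.* C′))          ≡⟨ cong (λ k → a′ ℚ.* (q ℚ.* ((toℚ (r !) ℚ.* inv X) ℚ.* toℚ (k C r)))) n∸|μ|≡m ⟨
  a′ ℚ.* (q ℚ.* ((toℚ (r !) ℚ.* inv X) ℚ.* toℚ ((n ∸ sum μ) C r))) ∎
  where
  open ≡-Reasoning
  open ℚSolver
  r = length μ
  a = inv (n !)
  a′ = inv (m !)
  q = invSucProd μ
  X = multFactProd μ
  C′ = toℚ (m C r)
  n∸|μ|≡m : n ∸ sum μ ≡ m
  n∸|μ|≡m = trans (cong (_∸ sum μ) (sym m+|μ|≡n)) (ℕₚ.m+n∸n≡m m (sum μ))

module ℚAlgebra {c ℓ : Level} (R : CommutativeRing c ℓ) {ι : ℚ → CommutativeRing.Carrier R}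
                (hom : IsℚAlgebraMap R ι) where
  open CommutativeRing R renaming (refl to ≈-refl; sym to ≈-sym; trans to ≈-trans)
  open RingMorphisms.IsRingHomomorphism hom using (*-homo; 1#-homo)
  open CommutativeSemigroupProperties *-commutativeSemigroup using (x∙yz≈y∙xz; x∙yz≈xz∙y)
  open Sums commutativeSemiring using (∏-map-*)
  open import Relation.Binary.Reasoning.Setoid setoid

  ι-∏ : ∀ {A : Set} (f : A → ℚ) (L : List A) → ι (ℚ∑.∏ (map f L)) ≈ prodR R (map (ι ∘ f) L)
  ι-∏ f []      = 1#-homo
  ι-∏ f (x ∷ L) = ≈-trans (*-homo (f x) _) (*-congˡ (ι-∏ f L))

  𝒢̃≈ι[invSucProd]*𝒢 : ∀ g μ → 𝒢̃ R ι g μ ≈ ι (invSucProd μ) * 𝒢 R ι g μ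
  𝒢̃≈ι[invSucProd]*𝒢 g μ = ≈-trans (∏-map-* (λ x → ι (inv (suc x))) (g ∘ suc) μ)
                                   (*-congʳ (≈-sym (ι-∏ (λ x → inv (suc x)) μ)))

  ι-pull : ∀ a b d G → ι a * (G * (ι b * ι d)) ≈ ι (a ℚ.* (b ℚ.* d)) * G
  ι-pull a b d G = begin
    ι a * (G * (ι b * ι d))   ≈⟨ x∙yz≈xz∙y (ι a) G (ι b * ι d) ⟩
    ι a * (ι b * ι d) * G     ≈⟨ *-congʳ (*-congˡ (*-homo b d)) ⟨
    ι a * ι (b ℚ.* d) * G     ≈⟨ *-congʳ (*-homo a (b ℚ.* d)) ⟨
    ι (a ℚ.* (b ℚ.* d)) * G   ∎

  ι-pull-scaled : ∀ a q b d G → ι a * ((ι q * G) * (ι b * ι d)) ≈ ι (a ℚ.* (q ℚ.* (b ℚ.* d))) * G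
  ι-pull-scaled a q b d G = begin
    ι a * ((ι q * G) * (ι b * ι d))   ≈⟨ *-congˡ (*-assoc (ι q) G (ι b * ι d)) ⟩
    ι a * (ι q * (G * (ι b * ι d)))   ≈⟨ x∙yz≈y∙xz (ι a) (ι q) _ ⟩
    ι q * (ι a * (G * (ι b * ι d)))   ≈⟨ *-congˡ (ι-pull a b d G) ⟩
    ι q * (ι (a ℚ.* (b ℚ.* d)) * G)   ≈⟨ *-assoc (ι q) _ G ⟨
    ι q * ι (a ℚ.* (b ℚ.* d)) * G     ≈⟨ *-congʳ (*-homo q (a ℚ.* (b ℚ.* d))) ⟨
    ι (q ℚ.* (a ℚ.* (b ℚ.* d))) * G   ≡⟨ cong (λ z → ι z * G) (solve 4 (λ q a b d → q :* (a :* (b :* d)) := a :* (q :* (b :* d))) refl q a b d) ⟩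
    ι (a ℚ.* (q ℚ.* (b ℚ.* d))) * G   ∎
    where open ℚSolver

  partition-term-ι : ∀ g {m n μ} → m ℕ.+ sum μ ≡ n → All (1 ≤_) μ →
    ι (inv (n !)) * (𝒢 R ι g μ * (ι (toℚ (fallProd n (sum μ ℕ.+ length μ))) * ι (orbitSum μ))) ≈
    ι (inv (m !)) * (𝒢̃ R ι g μ * (ι (toℚ (length μ !) ℚ.* inv (multFactProd μ)) * ι (toℚ ((n ∸ sum μ) C length μ))))
  partition-term-ι g {m} {n} {μ} m+|μ|≡n pos = begin
    ι (inv (n !)) * (G * (ι b * ι d))            ≈⟨ ι-pull (inv (n !)) b d G ⟩
    ι (inv (n !) ℚ.* (b ℚ.* d)) * G             ≡⟨ cong (λ z → ι z * G) (partition-term m+|μ|≡n pos) ⟩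
    ι (inv (m !) ℚ.* (q ℚ.* (e ℚ.* f))) * G     ≈⟨ ι-pull-scaled (inv (m !)) q e f G ⟨
    ι (inv (m !)) * ((ι q * G) * (ι e * ι f))   ≈⟨ *-congˡ (*-congʳ (𝒢̃≈ι[invSucProd]*𝒢 g μ)) ⟨
    ι (inv (m !)) * (𝒢̃ R ι g μ * (ι e * ι f))  ∎
    where
    G = 𝒢 R ι g μ
    b = toℚ (fallProd n (sum μ ℕ.+ length μ))
    d = orbitSum μ
    q = invSucProd μ
    e = toℚ (length μ !) ℚ.* inv (multFactProd μ)
    f = toℚ ((n ∸ sum μ) C length μ)

mainTheorem4 : {c ℓ : Level} (R : CommutativeRing c ℓ)
    (ι : ℚ → CommutativeRing.Carrier R) → IsℚAlgebraMap R ι →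
    (g : ℕ → CommutativeRing.Carrier R) →
    CommutativeRing._≈_ R (g 1) (CommutativeRing.1# R) →
    (m n : ℕ) → 1 ≤ m → m < n →
    CommutativeRing._≈_ R (LHS R ι g m n) (RHS R ι g m n)
mainTheorem4 R ι hom g _ m n _ m<n = begin
  ι (inv (n !)) * sumR R (map lhs P)              ≈⟨ *-distribˡ-∑ _ lhs P ⟩
  sumR R (map (λ μ → ι (inv (n !)) * lhs μ) P)    ≈⟨ ∑-cong P termwise ⟩
  sumR R (map (λ μ → ι (inv (m !)) * rhs μ) P)    ≈⟨ *-distribˡ-∑ _ rhs P ⟨
  ι (inv (m !)) * sumR R (map rhs P)              ∎
  where
  open CommutativeRing R using (Carrier; _≈_; _*_; setoid; commutativeSemiring)
  open Sums commutativeSemiring using (∑-cong; *-distribˡ-∑)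
  open ℚAlgebra R hom using (partition-term-ι)
  open import Relation.Binary.Reasoning.Setoid setoid
  P = partitions (n ∸ m)
  lhs rhs : List ℕ → Carrier
  lhs μ = 𝒢 R ι g μ * (ι (toℚ (fallProd n (sum μ ℕ.+ length μ))) * ι (orbitSum μ))
  rhs μ = 𝒢̃ R ι g μ * (ι (toℚ (length μ !) ℚ.* inv (multFactProd μ)) * ι (toℚ ((n ∸ sum μ) C length μ)))
  termwise : ∀ {μ} → μ ∈ P → ι (inv (n !)) * lhs μ ≈ ι (inv (m !)) * rhs μ
  termwise μ∈P with ∈-partitions⁻ μ∈P
  ... | |μ|≡n∸m , pos = partition-term-ι g (trans (cong (m ℕ.+_) |μ|≡n∸m) (ℕₚ.m+[n∸m]≡n (ℕₚ.<⇒≤ m<n))) pos
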